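{- Let $n\geq 2$, $u\in\mathfrak{S}_n$ and $a,b\in[n-1]$ such that $s_au=us_b$ (so that $u(\{b,b+1\})=\{a,a+1\}$). Then $u$ and $s_au$ are both in $\mathfrak{W}_m^+$ or both in $\mathfrak{W}_m^-$ for some $m$ if and only if $2\leq b\leq n-2$ and $u(b-1)$ and $u(b+2)$ are both $<a$ or both $>a+1$.
   Context: Permutations are composed as functions, $(\alpha\beta)(i)=\alpha(\beta(i))$, and $s_i$ denotes the transposition $(i,i+1)$. An alternating run of $\sigma\in\mathfrak{S}_n$ (written as the word $\sigma(1)\cdots\sigma(n)$) is a maximal monotone sequence of consecutive entries; $\mathrm{run}(\sigma)$ is their number. $\mathfrak{W}_m^+$ (resp. $\mathfrak{W}_m^-$) is the set of $\sigma\in\mathfrak{S}_n$ with $\mathrm{run}(\sigma)=m$ whose first run is ascending (resp. descending). -}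

module Defs where

open import Data.Nat using (ℕ; zero; suc; _+_; _∸_; _≤_; _<_; _≤?_; _<?_; _<ᵇ_)
open import Data.Nat.Properties using (≤-<-trans; m∸n≤m)
open import Data.Fin using (Fin; toℕ; fromℕ<)
open import Data.Fin.Permutation using (Permutation′; _⟨$⟩ʳ_; _∘ₚ_; transpose; id)
open import Data.List using (List; []; _∷_; map; allFin)
open import Data.Bool using (Bool; true; false; if_then_else_)
open import Data.Bool.Properties using () renaming (_≟_ to _≟ᵇ_)
open import Data.Maybe using (Maybe; just; nothing)
open import Data.Product using (_×_)
open import Relation.Nullary using (yes; no)
open import Relation.Binary.PropositionalEquality using (_≡_)

-- Values of a permutation of Fin n are read 1-based: position i (1..n)
-- corresponds to Fin element i-1, and value k to Fin element k-1.

-- Composition as functions: (α · β)(i) = α(β(i)).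
-- (stdlib's _∘ₚ_ is diagrammatic: (π₁ ∘ₚ π₂) applies π₁ first.)
_·_ : ∀ {n} → Permutation′ n → Permutation′ n → Permutation′ n
α · β = β ∘ₚ α

-- s a = the transposition (a, a+1) (1-based), for 1 ≤ a ≤ n-1;
-- identity for out-of-range a (never used under the hypotheses).
s : ∀ {n} → ℕ → Permutation′ n
s {n} a with 1 ≤? a | a <? n
... | yes _ | yes a<n = transpose (fromℕ< (≤-<-trans (m∸n≤m a 1) a<n)) (fromℕ< a<n)
... | _     | _       = id

-- σ(i) for 1-based i ∈ [1,n], as a 1-based value; 0 out of range
-- (never used under the hypotheses of the lemma).
app : ∀ {n} → Permutation′ n → ℕ → ℕ
app {n} σ zero = 0
app {n} σ (suc j) with suc j ≤? n
... | yes j<n = suc (toℕ (σ ⟨$⟩ʳ fromℕ< j<n))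
... | no  _   = 0

word : ∀ {n} → Permutation′ n → List ℕ
word {n} σ = map (λ i → suc (toℕ (σ ⟨$⟩ʳ i))) (allFin n)

dirs : List ℕ → List Bool
dirs (x ∷ y ∷ t) = (x <ᵇ y) ∷ dirs (y ∷ t)
dirs _           = []

blocksFrom : Bool → List Bool → ℕ
blocksFrom x []      = 1
blocksFrom x (y ∷ t) with x ≟ᵇ y
... | yes _ = blocksFrom y t
... | no  _ = suc (blocksFrom y t)

blocks : List Bool → ℕ
blocks []      = 0
blocks (x ∷ t) = blocksFrom x t

-- run(σ): number of alternating runs (maximal monotone segments of
-- consecutive entries) = number of maximal blocks of equal step directions.
run : ∀ {n} → Permutation′ n → ℕ
run σ = blocks (dirs (word σ))

firstDir : ∀ {n} → Permutation′ n → Maybe Bool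
firstDir σ with dirs (word σ)
... | []    = nothing
... | d ∷ _ = just d

W⁺ : ∀ {n} → ℕ → Permutation′ n → Set
W⁺ m σ = run σ ≡ m × firstDir σ ≡ just true

W⁻ : ∀ {n} → ℕ → Permutation′ n → Set
W⁻ m σ = run σ ≡ m × firstDir σ ≡ just false

module Submission where

-- Since s_a u = u s_b, the word of s_a u is that of u with the adjacent entries u(b), u(b+1)
-- exchanged, and by injectivity these are a and a + 1 in some order. Only the direction
-- between them flips: the neighbours u(b-1) and u(b+2) lie outside {a, a+1}, so each
-- compares with a and with a + 1 in the same way. Flipping the first direction (b = 1)
-- changes the first run, flipping the last one (b = n-1) changes the number of runs, and
-- flipping an interior direction between directions α and γ keeps the number of runs iff
-- α ≠ γ, i.e. iff u(b-1) and u(b+2) are both below a or both above a + 1.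

open import Defs
open import Data.Nat using (ℕ; zero; suc; _+_; _∸_; _≤_; _<_; _>_; _<ᵇ_; z≤n; s≤s; z<s; s<s; _≟_; _<?_)
open import Data.Nat.Properties
open import Data.Fin using (Fin; toℕ; fromℕ<)
open import Data.Fin.Properties using (toℕ-fromℕ<; fromℕ<-toℕ; toℕ-injective; toℕ<n)
  renaming (_≟_ to _≟ᶠ_)
open import Data.Fin.Permutation using (Permutation′; _≈_; _⟨$⟩ʳ_; _⟨$⟩ˡ_; inverseˡ)
import Data.Fin.Permutation.Components as PC
open import Data.List using (List; []; _∷_; _++_; _∷ʳ_; head; applyUpTo; tabulate)
open import Data.List.Properties using (map-tabulate; tabulate-cong; applyUpTo-∷ʳ)
open import Data.Bool using (Bool; true; false)
open import Data.Bool.Properties using () renaming (_≟_ to _≟ᵇ_)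
open import Data.Maybe using (just)
open import Data.Maybe.Properties using (just-injective)
open import Data.Product using (_×_; _,_; ∃-syntax; proj₁; proj₂)
open import Data.Sum using (_⊎_; inj₁; inj₂)
open import Data.Empty using (⊥-elim)
open import Function using (_∘_)
open import Function.Bundles using (_⇔_; mk⇔; Equivalence)
import Function.Properties.Equivalence as ⇔
open import Relation.Nullary using (¬_; yes; no)
open import Relation.Nullary.Decidable using (dec-true; dec-false)
open import Relation.Binary using (tri<; tri≈; tri>)
open import Relation.Binary.PropositionalEquality

-- These hold by the Dec lemmas because does (m <? n) computes to m <ᵇ n.
<ᵇ-true : ∀ {m n} → m < n → (m <ᵇ n) ≡ true
<ᵇ-true = dec-true (_ <? _)

<ᵇ-false : ∀ {m n} → ¬ m < n → (m <ᵇ n) ≡ false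
<ᵇ-false = dec-false (_ <? _)

a<ᵇ1+a : ∀ a → (a <ᵇ suc a) ≡ true
a<ᵇ1+a a = <ᵇ-true (n<1+n a)

1+a<ᵇa : ∀ a → (suc a <ᵇ a) ≡ false
1+a<ᵇa a = <ᵇ-false (<-asym (n<1+n a))

true≢false : true ≢ false
true≢false ()

Outside : ℕ → ℕ → Set
Outside a z = z < a ⊎ suc a < z

outside : ∀ {a z} → z ≢ a → z ≢ suc a → Outside a z
outside {a} {z} z≢a z≢1+a with <-cmp z a
... | tri< z<a _ _ = inj₁ z<a
... | tri≈ _ z≡a _ = ⊥-elim (z≢a z≡a)
... | tri> _ _ a<z = inj₂ (≤∧≢⇒< a<z (z≢1+a ∘ sym))

<ᵇ-outsideˡ : ∀ {a z} → Outside a z → (z <ᵇ suc a) ≡ (z <ᵇ a)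
<ᵇ-outsideˡ (inj₁ z<a) = trans (<ᵇ-true (m<n⇒m<1+n z<a)) (sym (<ᵇ-true z<a))
<ᵇ-outsideˡ {a} (inj₂ 1+a<z) =
  trans (<ᵇ-false (<-asym 1+a<z)) (sym (<ᵇ-false (<-asym (<-trans (n<1+n a) 1+a<z))))

<ᵇ-outsideʳ : ∀ {a v} → Outside a v → (a <ᵇ v) ≡ (suc a <ᵇ v)
<ᵇ-outsideʳ (inj₁ v<a) = trans (<ᵇ-false (<-asym v<a)) (sym (<ᵇ-false (<-asym (m<n⇒m<1+n v<a))))
<ᵇ-outsideʳ {a} (inj₂ 1+a<v) = trans (<ᵇ-true (<-trans (n<1+n a) 1+a<v)) (sym (<ᵇ-true 1+a<v))

SameSide : ℕ → ℕ → ℕ → Set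
SameSide a z v = (z < a × v < a) ⊎ (z > a + 1 × v > a + 1)

sameSide⇔ : ∀ {a z v} → Outside a z → Outside a v → SameSide a z v ⇔ ((z <ᵇ a) ≢ (suc a <ᵇ v))
sameSide⇔ {a} {z} {v} oz ov = mk⇔ to (from oz ov)
  where
  a+1≡1+a : a + 1 ≡ suc a
  a+1≡1+a = +-comm a 1

  to : SameSide a z v → (z <ᵇ a) ≢ (suc a <ᵇ v)
  to (inj₁ (z<a , v<a)) eq =
    true≢false (trans (sym (<ᵇ-true z<a)) (trans eq (<ᵇ-false (<-asym (m<n⇒m<1+n v<a)))))
  to (inj₂ (a+1<z , a+1<v)) eq =
    true≢false (trans (sym (<ᵇ-true (subst (_< v) a+1≡1+a a+1<v)))
                (trans (sym eq) (<ᵇ-false (<-asym (<-trans (n<1+n a) (subst (_< z) a+1≡1+a a+1<z))))))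

  from : Outside a z → Outside a v → (z <ᵇ a) ≢ (suc a <ᵇ v) → SameSide a z v
  from (inj₁ z<a)   (inj₁ v<a)   _ = inj₁ (z<a , v<a)
  from (inj₂ 1+a<z) (inj₂ 1+a<v) _ =
    inj₂ (subst (_< z) (sym a+1≡1+a) 1+a<z , subst (_< v) (sym a+1≡1+a) 1+a<v)
  from (inj₁ z<a)   (inj₂ 1+a<v) ne = ⊥-elim (ne (trans (<ᵇ-true z<a) (sym (<ᵇ-true 1+a<v))))
  from (inj₂ 1+a<z) (inj₁ v<a)   ne =
    ⊥-elim (ne (trans (<ᵇ-false (<-asym (<-trans (n<1+n a) 1+a<z)))
                      (sym (<ᵇ-false (<-asym (m<n⇒m<1+n v<a))))))

n≢2+n : ∀ n → n ≢ suc (suc n)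
n≢2+n n = <⇒≢ (m<n⇒m<1+n (n<1+n n))

blocksFrom-flip⇔ : ∀ α γ T →
  (blocksFrom α (true ∷ γ ∷ T) ≡ blocksFrom α (false ∷ γ ∷ T)) ⇔ (α ≢ γ)
blocksFrom-flip⇔ true  true  T = mk⇔ (λ eq → ⊥-elim (n≢2+n _ eq)) (λ ne → ⊥-elim (ne refl))
blocksFrom-flip⇔ true  false T = mk⇔ (λ _ ()) (λ _ → refl)
blocksFrom-flip⇔ false true  T = mk⇔ (λ _ ()) (λ _ → refl)
blocksFrom-flip⇔ false false T = mk⇔ (λ eq → ⊥-elim (n≢2+n _ (sym eq))) (λ ne → ⊥-elim (ne refl))

blocksFrom-flip-last : ∀ α → blocksFrom α (true ∷ []) ≢ blocksFrom α (false ∷ [])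
blocksFrom-flip-last true  ()
blocksFrom-flip-last false ()

blocksFrom-++-∷ : ∀ x D α → ∃[ k ] ∀ E → blocksFrom x (D ++ α ∷ E) ≡ k + blocksFrom α E
blocksFrom-++-∷ x [] α with x ≟ᵇ α
... | yes _ = 0 , λ _ → refl
... | no  _ = 1 , λ _ → refl
blocksFrom-++-∷ x (y ∷ D) α with x ≟ᵇ y
... | yes _ = blocksFrom-++-∷ y D α
... | no  _ with k , eq ← blocksFrom-++-∷ y D α = suc k , λ E → cong suc (eq E)

blocks-++-∷ : ∀ D α → ∃[ k ] ∀ E → blocks (D ++ α ∷ E) ≡ k + blocksFrom α E
blocks-++-∷ []      α = 0 , λ _ → refl
blocks-++-∷ (d ∷ D) α = blocksFrom-++-∷ d D α

blocks-++-∷-≡⇔ : ∀ D α E E′ →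
  (blocks (D ++ α ∷ E) ≡ blocks (D ++ α ∷ E′)) ⇔ (blocksFrom α E ≡ blocksFrom α E′)
blocks-++-∷-≡⇔ D α E E′ with k , eq ← blocks-++-∷ D α =
  mk⇔ (λ blocks≡ → +-cancelˡ-≡ k _ _ (trans (sym (eq E)) (trans blocks≡ (eq E′))))
      (λ blocksFrom≡ → trans (eq E) (trans (cong (k +_) blocksFrom≡) (sym (eq E′))))

head-++-∷ : ∀ D (α : Bool) E E′ → head (D ++ α ∷ E) ≡ head (D ++ α ∷ E′)
head-++-∷ []      α E E′ = refl
head-++-∷ (d ∷ D) α E E′ = refl

SameRunShape : List Bool → List Bool → Set
SameRunShape D D′ = blocks D ≡ blocks D′ × head D ≡ head D′

SameRunShape-sym : ∀ {D D′} → SameRunShape D D′ → SameRunShape D′ D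
SameRunShape-sym (blocks≡ , head≡) = sym blocks≡ , sym head≡

SameRunShape-flip⇔ : ∀ D α γ T →
  SameRunShape (D ++ α ∷ true ∷ γ ∷ T) (D ++ α ∷ false ∷ γ ∷ T) ⇔ (α ≢ γ)
SameRunShape-flip⇔ D α γ T = mk⇔
  (λ (blocks≡ , _) → to flip⇔ (to (blocks-++-∷-≡⇔ D α _ _) blocks≡))
  (λ α≢γ → from (blocks-++-∷-≡⇔ D α _ _) (from flip⇔ α≢γ) , head-++-∷ D α _ _)
  where
  open Equivalence
  flip⇔ : (blocksFrom α (true ∷ γ ∷ T) ≡ blocksFrom α (false ∷ γ ∷ T)) ⇔ (α ≢ γ)
  flip⇔ = blocksFrom-flip⇔ α γ T

¬SameRunShape-flip-last : ∀ D α → ¬ SameRunShape (D ++ α ∷ true ∷ []) (D ++ α ∷ false ∷ [])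
¬SameRunShape-flip-last D α (blocks≡ , _) =
  blocksFrom-flip-last α (Equivalence.to (blocks-++-∷-≡⇔ D α _ _) blocks≡)

dirs-∷ʳ-++ : ∀ P z R → dirs (P ∷ʳ z ++ R) ≡ dirs (P ∷ʳ z) ++ dirs (z ∷ R)
dirs-∷ʳ-++ []          z R = refl
dirs-∷ʳ-++ (p ∷ [])    z R = refl
dirs-∷ʳ-++ (p ∷ q ∷ P) z R = cong ((p <ᵇ q) ∷_) (dirs-∷ʳ-++ (q ∷ P) z R)

SwapKeepsRuns : ℕ → List ℕ → List ℕ → Set
SwapKeepsRuns a P Q = SameRunShape (dirs (P ++ a ∷ suc a ∷ Q)) (dirs (P ++ suc a ∷ a ∷ Q))

¬SwapKeepsRuns-first : ∀ a Q → ¬ SwapKeepsRuns a [] Q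
¬SwapKeepsRuns-first a Q (_ , head≡) =
  true≢false (trans (sym (a<ᵇ1+a a)) (trans (just-injective head≡) (1+a<ᵇa a)))

¬SwapKeepsRuns-last : ∀ {a z} P → Outside a z → ¬ SwapKeepsRuns a (P ∷ʳ z) []
¬SwapKeepsRuns-last {a} {z} P oz
  rewrite dirs-∷ʳ-++ P z (a ∷ suc a ∷ []) | dirs-∷ʳ-++ P z (suc a ∷ a ∷ [])
        | <ᵇ-outsideˡ oz | a<ᵇ1+a a | 1+a<ᵇa a
  = ¬SameRunShape-flip-last (dirs (P ∷ʳ z)) (z <ᵇ a)

SwapKeepsRuns-interior⇔ : ∀ {a z v} P Q → Outside a z → Outside a v →
  SwapKeepsRuns a (P ∷ʳ z) (v ∷ Q) ⇔ SameSide a z v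
SwapKeepsRuns-interior⇔ {a} {z} {v} P Q oz ov
  rewrite dirs-∷ʳ-++ P z (a ∷ suc a ∷ v ∷ Q) | dirs-∷ʳ-++ P z (suc a ∷ a ∷ v ∷ Q)
        | <ᵇ-outsideˡ oz | <ᵇ-outsideʳ ov | a<ᵇ1+a a | 1+a<ᵇa a
  = ⇔.trans (SameRunShape-flip⇔ (dirs (P ∷ʳ z)) (z <ᵇ a) (suc a <ᵇ v) (dirs (v ∷ Q)))
            (⇔.sym (sameSide⇔ oz ov))

Adjacent : ℕ → ℕ → ℕ → Set
Adjacent a x y = (x ≡ a × y ≡ suc a) ⊎ (x ≡ suc a × y ≡ a)

SameRunShape-swap-normalise : ∀ {a x y} P Q → Adjacent a x y →
  SameRunShape (dirs (P ++ x ∷ y ∷ Q)) (dirs (P ++ y ∷ x ∷ Q)) ⇔ SwapKeepsRuns a P Q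
SameRunShape-swap-normalise P Q (inj₁ (refl , refl)) = ⇔.refl
SameRunShape-swap-normalise P Q (inj₂ (refl , refl)) = mk⇔ SameRunShape-sym SameRunShape-sym

after : (ℕ → ℕ) → ℕ → ℕ → List ℕ
after f c r = applyUpTo (λ i → f (c + suc (suc i))) r

applyUpTo-split : ∀ (f : ℕ → ℕ) c r →
  applyUpTo f (c + suc (suc r)) ≡ applyUpTo f c ++ f c ∷ f (suc c) ∷ after f c r
applyUpTo-split f zero    r = refl
applyUpTo-split f (suc c) r = cong (f 0 ∷_) (applyUpTo-split (f ∘ suc) c r)

applyUpTo-cong-< : ∀ {f g : ℕ → ℕ} m → (∀ {i} → i < m → f i ≡ g i) →
  applyUpTo f m ≡ applyUpTo g m
applyUpTo-cong-< zero    f≡g = refl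
applyUpTo-cong-< (suc m) f≡g = cong₂ _∷_ (f≡g z<s) (applyUpTo-cong-< m (f≡g ∘ s<s))

OffPair : ℕ → ℕ → ℕ → Set
OffPair n c k = k < n × k ≢ c × k ≢ suc c

before-offPair : ∀ {c r i} → i < c → OffPair (c + suc (suc r)) c i
before-offPair {c} i<c = <-≤-trans i<c (m≤m+n c _) , <⇒≢ i<c , <⇒≢ (m<n⇒m<1+n i<c)

after-offPair : ∀ {c r i} → i < r → OffPair (c + suc (suc r)) c (c + suc (suc i))
after-offPair {c} {i = i} i<r =
  +-monoʳ-< c (s<s (s<s i<r)) ,
  ≢-sym (<⇒≢ (m<m+n c z<s)) ,
  (λ eq → <⇒≢ (m<m+n c z<s) (sym (suc-injective (trans (sym (+-suc c (suc i))) eq))))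

1+m≤[m+2+n]∸2⇔1≤n : ∀ m n → (suc m ≤ (m + suc (suc n)) ∸ 2) ⇔ (1 ≤ n)
1+m≤[m+2+n]∸2⇔1≤n m n rewrite +-suc m (suc n) | +-suc m n = mk⇔
  (λ 1+m≤m+n → +-cancelˡ-≤ m 1 n (subst (_≤ m + n) (+-comm 1 m) 1+m≤m+n))
  (λ 1≤n → subst (_≤ m + n) (+-comm m 1) (+-monoʳ-≤ m 1≤n))

SwapKeepsRuns-snoc⇔ : ∀ {a} (f : ℕ → ℕ) c Q →
  SwapKeepsRuns a (applyUpTo f (suc c)) Q ⇔ SwapKeepsRuns a (applyUpTo f c ∷ʳ f c) Q
SwapKeepsRuns-snoc⇔ {a} f c Q = mk⇔ (subst (λ P → SwapKeepsRuns a P Q) (sym (applyUpTo-∷ʳ f c)))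
                                    (subst (λ P → SwapKeepsRuns a P Q) (applyUpTo-∷ʳ f c))

-- h is a 1-based sequence, as app is: the word consists of h 1, …, h n.
adjacentSwap⇔ : ∀ (h : ℕ → ℕ) c r {a} →
  (∀ {k} → OffPair (c + suc (suc r)) c k → Outside a (h (suc k))) →
  SwapKeepsRuns a (applyUpTo (h ∘ suc) c) (after (h ∘ suc) c r)
    ⇔ (2 ≤ suc c × suc c ≤ (c + suc (suc r)) ∸ 2 × SameSide a (h c) (h (suc c + 2)))
adjacentSwap⇔ h zero r {a} _ =
  mk⇔ (⊥-elim ∘ ¬SwapKeepsRuns-first a (after (h ∘ suc) 0 r)) (λ { (s≤s () , _) })
adjacentSwap⇔ h (suc c) zero outside-h = mk⇔
  (⊥-elim ∘ ¬SwapKeepsRuns-last (applyUpTo (h ∘ suc) c) (outside-h (before-offPair (n<1+n c)))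
          ∘ Equivalence.to (SwapKeepsRuns-snoc⇔ (h ∘ suc) c []))
  (λ (_ , b≤n∸2 , _) → ⊥-elim (1+n≰n (Equivalence.to (1+m≤[m+2+n]∸2⇔1≤n (suc c) 0) b≤n∸2)))
adjacentSwap⇔ h (suc c) (suc r) outside-h =
  ⇔.trans (SwapKeepsRuns-snoc⇔ (h ∘ suc) c _)
  (⇔.trans (SwapKeepsRuns-interior⇔ (applyUpTo (h ∘ suc) c) _
              (outside-h (before-offPair (n<1+n c))) (outside-h (after-offPair z<s)))
           (mk⇔ (λ same → s≤s (s≤s z≤n) , b≤n∸2 , same) (proj₂ ∘ proj₂)))
  where
  b≤n∸2 : suc (suc c) ≤ (suc c + suc (suc (suc r))) ∸ 2
  b≤n∸2 = Equivalence.from (1+m≤[m+2+n]∸2⇔1≤n (suc c) (suc r)) (s≤s z≤n)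

swap : ℕ → ℕ → ℕ
swap a x with x ≟ a
... | yes _ = suc a
... | no  _ with x ≟ suc a
...   | yes _ = a
...   | no  _ = x

swap-a : ∀ a → swap a a ≡ suc a
swap-a a with a ≟ a
... | yes _   = refl
... | no  a≢a = ⊥-elim (a≢a refl)

swap-suc : ∀ a → swap a (suc a) ≡ a
swap-suc a with suc a ≟ a
... | yes 1+a≡a = ⊥-elim (1+n≢n 1+a≡a)
... | no  _ with suc a ≟ suc a
...   | yes _       = refl
...   | no  1+a≢1+a = ⊥-elim (1+a≢1+a refl)

swap-other : ∀ {a x} → x ≢ a → x ≢ suc a → swap a x ≡ x
swap-other {a} {x} x≢a x≢1+a with x ≟ a
... | yes x≡a = ⊥-elim (x≢a x≡a)
... | no  _ with x ≟ suc a
...   | yes x≡1+a = ⊥-elim (x≢1+a x≡1+a)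
...   | no  _     = refl

1+m<m+2+n : ∀ m n → suc m < m + suc (suc n)
1+m<m+2+n m n = subst (suc m <_) (sym (+-suc m (suc n))) (s<s (m<m+n m z<s))

module AdjacentTransposition {c r a : ℕ} {f g : ℕ → ℕ}
  (f-injective : ∀ {k k′} → k < c + suc (suc r) → k′ < c + suc (suc r) → f k ≡ f k′ → k ≡ k′)
  (g≡swap∘f : ∀ {k} → k < c + suc (suc r) → g k ≡ swap a (f k))
  (g-c : g c ≡ f (suc c)) where

  n : ℕ
  n = c + suc (suc r)

  1+c<n : suc c < n
  1+c<n = 1+m<m+2+n c r

  c<n : c < n
  c<n = <-trans (n<1+n c) 1+c<n

  swap-fc : swap a (f c) ≡ f (suc c)
  swap-fc = trans (sym (g≡swap∘f c<n)) g-c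

  adjacent : Adjacent a (f c) (f (suc c))
  adjacent with f c ≟ a
  ... | yes fc≡a = inj₁ (fc≡a , trans (sym swap-fc) (trans (cong (swap a) fc≡a) (swap-a a)))
  ... | no  fc≢a with f c ≟ suc a
  ...   | yes fc≡1+a = inj₂ (fc≡1+a , trans (sym swap-fc) (trans (cong (swap a) fc≡1+a) (swap-suc a)))
  ...   | no  fc≢1+a = ⊥-elim (<⇒≢ (n<1+n c)
          (f-injective c<n 1+c<n (trans (sym (swap-other fc≢a fc≢1+a)) swap-fc)))

  g-suc : g (suc c) ≡ f c
  g-suc with adjacent
  ... | inj₁ (fc≡a , f1+c≡1+a) =
    trans (g≡swap∘f 1+c<n) (trans (cong (swap a) f1+c≡1+a) (trans (swap-suc a) (sym fc≡a)))
  ... | inj₂ (fc≡1+a , f1+c≡a) =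
    trans (g≡swap∘f 1+c<n) (trans (cong (swap a) f1+c≡a) (trans (swap-a a) (sym fc≡1+a)))

  f-≢ : ∀ {k j} → k < n → j < n → k ≢ j → f k ≢ f j
  f-≢ k<n j<n k≢j = k≢j ∘ f-injective k<n j<n

  f-avoids : ∀ {k} → OffPair n c k → f k ≢ a × f k ≢ suc a
  f-avoids (k<n , k≢c , k≢1+c) with adjacent
  ... | inj₁ (fc≡a , f1+c≡1+a) =
    (λ fk≡a   → f-≢ k<n c<n   k≢c   (trans fk≡a (sym fc≡a))) ,
    (λ fk≡1+a → f-≢ k<n 1+c<n k≢1+c (trans fk≡1+a (sym f1+c≡1+a)))
  ... | inj₂ (fc≡1+a , f1+c≡a) =
    (λ fk≡a   → f-≢ k<n 1+c<n k≢1+c (trans fk≡a (sym f1+c≡a))) ,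
    (λ fk≡1+a → f-≢ k<n c<n   k≢c   (trans fk≡1+a (sym fc≡1+a)))

  f-outside : ∀ {k} → OffPair n c k → Outside a (f k)
  f-outside off = outside (proj₁ (f-avoids off)) (proj₂ (f-avoids off))

  g-off : ∀ {k} → OffPair n c k → g k ≡ f k
  g-off off@(k<n , _) =
    trans (g≡swap∘f k<n) (swap-other (proj₁ (f-avoids off)) (proj₂ (f-avoids off)))

  applyUpTo-g : applyUpTo g n ≡ applyUpTo f c ++ f (suc c) ∷ f c ∷ after f c r
  applyUpTo-g = begin
    applyUpTo g n                                   ≡⟨ applyUpTo-split g c r ⟩
    applyUpTo g c ++ g c ∷ g (suc c) ∷ after g c r  ≡⟨ cong₂ _++_ prefix middle ⟩
    applyUpTo f c ++ f (suc c) ∷ f c ∷ after f c r  ∎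
    where
    open ≡-Reasoning
    prefix : applyUpTo g c ≡ applyUpTo f c
    prefix = applyUpTo-cong-< c (g-off ∘ before-offPair)
    suffix : after g c r ≡ after f c r
    suffix = applyUpTo-cong-< r (g-off ∘ after-offPair)
    middle : g c ∷ g (suc c) ∷ after g c r ≡ f (suc c) ∷ f c ∷ after f c r
    middle = cong₂ _∷_ g-c (cong₂ _∷_ g-suc suffix)

tabulate-toℕ : ∀ {n} (f : ℕ → ℕ) → tabulate {n = n} (f ∘ toℕ) ≡ applyUpTo f n
tabulate-toℕ {zero}  f = refl
tabulate-toℕ {suc n} f = cong (f 0 ∷_) (tabulate-toℕ (f ∘ suc))

app-toℕ : ∀ {n} (σ : Permutation′ n) (i : Fin n) → app σ (suc (toℕ i)) ≡ suc (toℕ (σ ⟨$⟩ʳ i))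
app-toℕ {n} σ i with suc (toℕ i) ≤? n
... | yes i<n = cong (λ j → suc (toℕ (σ ⟨$⟩ʳ j))) (fromℕ<-toℕ i i<n)
... | no  i≮n = ⊥-elim (i≮n (toℕ<n i))

app-fromℕ< : ∀ {n} (σ : Permutation′ n) {k} (k<n : k < n) →
  app σ (suc k) ≡ suc (toℕ (σ ⟨$⟩ʳ fromℕ< k<n))
app-fromℕ< σ k<n = trans (cong (app σ ∘ suc) (sym (toℕ-fromℕ< k<n))) (app-toℕ σ (fromℕ< k<n))

word≡applyUpTo : ∀ {n} (σ : Permutation′ n) → word σ ≡ applyUpTo (app σ ∘ suc) n
word≡applyUpTo σ =
  trans (map-tabulate (λ i → i) _)
        (trans (tabulate-cong (λ i → sym (app-toℕ σ i))) (tabulate-toℕ (app σ ∘ suc)))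

app-injective : ∀ {n} (σ : Permutation′ n) {k k′} → k < n → k′ < n →
  app σ (suc k) ≡ app σ (suc k′) → k ≡ k′
app-injective σ {k} {k′} k<n k′<n eq = begin
  k                                  ≡⟨ toℕ-fromℕ< k<n ⟨
  toℕ (fromℕ< k<n)                   ≡⟨ cong toℕ (⟨$⟩ʳ-injective (toℕ-injective σ-eq)) ⟩
  toℕ (fromℕ< k′<n)                  ≡⟨ toℕ-fromℕ< k′<n ⟩
  k′                                 ∎
  where
  open ≡-Reasoning
  σ-eq : toℕ (σ ⟨$⟩ʳ fromℕ< k<n) ≡ toℕ (σ ⟨$⟩ʳ fromℕ< k′<n)
  σ-eq = suc-injective (trans (sym (app-fromℕ< σ k<n)) (trans eq (app-fromℕ< σ k′<n)))
  ⟨$⟩ʳ-injective : ∀ {i j} → σ ⟨$⟩ʳ i ≡ σ ⟨$⟩ʳ j → i ≡ j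
  ⟨$⟩ʳ-injective eq = trans (sym (inverseˡ σ)) (trans (cong (σ ⟨$⟩ˡ_) eq) (inverseˡ σ))

transpose-swap : ∀ {n a} (i j v : Fin n) → suc (toℕ i) ≡ a → toℕ j ≡ a →
  suc (toℕ (PC.transpose i j v)) ≡ swap a (suc (toℕ v))
transpose-swap {a = a} i j v i≡a j≡a with v ≟ᶠ i
... | yes refl = trans (cong suc j≡a) (sym (trans (cong (swap a) i≡a) (swap-a a)))
... | no  v≢i with v ≟ᶠ j
...   | yes refl = trans i≡a (sym (trans (cong (swap a ∘ suc) j≡a) (swap-suc a)))
...   | no  v≢j = sym (swap-other
          (λ eq → v≢i (toℕ-injective (suc-injective (trans eq (sym i≡a)))))
          (λ eq → v≢j (toℕ-injective (trans (suc-injective eq) (sym j≡a)))))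

s-⟨$⟩ʳ : ∀ {n a} → 1 ≤ a → a < n → (v : Fin n) → suc (toℕ (s a ⟨$⟩ʳ v)) ≡ swap a (suc (toℕ v))
s-⟨$⟩ʳ {n} {a} 1≤a a<n v with 1 ≤? a | a <? n
... | no  1≰a | _        = ⊥-elim (1≰a 1≤a)
... | yes _   | no  a≮n  = ⊥-elim (a≮n a<n)
... | yes _   | yes a<n′ =
  transpose-swap _ _ v (trans (cong suc (toℕ-fromℕ< _)) (m+[n∸m]≡n 1≤a)) (toℕ-fromℕ< a<n′)

app-s· : ∀ {n} (σ : Permutation′ n) {a} → 1 ≤ a → a < n →
  ∀ {k} → k < n → app (s a · σ) (suc k) ≡ swap a (app σ (suc k))
app-s· σ {a} 1≤a a<n k<n = begin
  app (s a · σ) (suc _)                     ≡⟨ app-fromℕ< (s a · σ) k<n ⟩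
  suc (toℕ (s a ⟨$⟩ʳ (σ ⟨$⟩ʳ fromℕ< k<n)))  ≡⟨ s-⟨$⟩ʳ 1≤a a<n _ ⟩
  swap a (suc (toℕ (σ ⟨$⟩ʳ fromℕ< k<n)))    ≡⟨ cong (swap a) (app-fromℕ< σ k<n) ⟨
  swap a (app σ (suc _))                    ∎
  where open ≡-Reasoning

app-·s : ∀ {n} (σ : Permutation′ n) {c} → suc c < n →
  app (σ · s (suc c)) (suc c) ≡ app σ (suc (suc c))
app-·s σ {c} 1+c<n = begin
  app (σ · s (suc c)) (suc c)            ≡⟨ app-fromℕ< (σ · s (suc c)) c<n ⟩
  suc (toℕ (σ ⟨$⟩ʳ j))                  ≡⟨ app-toℕ σ j ⟨
  app σ (suc (toℕ j))                   ≡⟨ cong (app σ) (trans (s-⟨$⟩ʳ (s≤s z≤n) 1+c<n _) swapped) ⟩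
  app σ (suc (suc c))                   ∎
  where
  open ≡-Reasoning
  c<n : c < _
  c<n = <-trans (n<1+n c) 1+c<n
  j : Fin _
  j = s (suc c) ⟨$⟩ʳ fromℕ< c<n
  swapped : swap (suc c) (suc (toℕ (fromℕ< c<n))) ≡ suc (suc c)
  swapped = trans (cong (swap (suc c) ∘ suc) (toℕ-fromℕ< c<n)) (swap-a (suc c))

app-cong : ∀ {n} {σ τ : Permutation′ n} → σ ≈ τ →
  ∀ {k} → k < n → app σ (suc k) ≡ app τ (suc k)
app-cong {σ = σ} {τ} σ≈τ k<n =
  trans (app-fromℕ< σ k<n) (trans (cong (suc ∘ toℕ) (σ≈τ _)) (sym (app-fromℕ< τ k<n)))

SameW : ∀ {n} → Permutation′ n → Permutation′ n → Set
SameW σ τ = ∃[ m ] ((W⁺ m σ × W⁺ m τ) ⊎ (W⁻ m σ × W⁻ m τ))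

firstDir≡head : ∀ {n} (σ : Permutation′ n) → firstDir σ ≡ head (dirs (word σ))
firstDir≡head σ with dirs (word σ)
... | []    = refl
... | _ ∷ _ = refl

SameW⇔SameRunShape : ∀ {n} {σ τ : Permutation′ n} → ∃[ d ] head (dirs (word σ)) ≡ just d →
  SameW σ τ ⇔ SameRunShape (dirs (word σ)) (dirs (word τ))
SameW⇔SameRunShape {σ = σ} {τ} (d , headσ) = mk⇔ to (from d headσ)
  where
  firstDirs≡ : ∀ {x} → firstDir σ ≡ x → firstDir τ ≡ x →
    head (dirs (word σ)) ≡ head (dirs (word τ))
  firstDirs≡ σ≡x τ≡x =
    trans (sym (firstDir≡head σ)) (trans σ≡x (trans (sym τ≡x) (firstDir≡head τ)))

  to : SameW σ τ → SameRunShape (dirs (word σ)) (dirs (word τ))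
  to (_ , inj₁ ((runσ , dirσ) , (runτ , dirτ))) = trans runσ (sym runτ) , firstDirs≡ dirσ dirτ
  to (_ , inj₂ ((runσ , dirσ) , (runτ , dirτ))) = trans runσ (sym runτ) , firstDirs≡ dirσ dirτ

  both-start : ∀ {d} → head (dirs (word σ)) ≡ just d →
    SameRunShape (dirs (word σ)) (dirs (word τ)) →
    (run σ ≡ run σ × firstDir σ ≡ just d) × (run τ ≡ run σ × firstDir τ ≡ just d)
  both-start headσ (runs≡ , heads≡) =
    (refl , trans (firstDir≡head σ) headσ) ,
    (sym runs≡ , trans (firstDir≡head τ) (trans (sym heads≡) headσ))

  from : ∀ d → head (dirs (word σ)) ≡ just d →
    SameRunShape (dirs (word σ)) (dirs (word τ)) → SameW σ τ
  from true  headσ same = run σ , inj₁ (both-start headσ same)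
  from false headσ same = run σ , inj₂ (both-start headσ same)

head-dirs-++-∷-∷ : ∀ P (x y : ℕ) Q → ∃[ d ] head (dirs (P ++ x ∷ y ∷ Q)) ≡ just d
head-dirs-++-∷-∷ []          x y Q = _ , refl
head-dirs-++-∷-∷ (p ∷ [])    x y Q = _ , refl
head-dirs-++-∷-∷ (p ∷ q ∷ P) x y Q = _ , refl

adjacentTransposition⇔ : ∀ c r (u : Permutation′ (c + suc (suc r))) {a} →
  1 ≤ a → a < c + suc (suc r) → (s a · u) ≈ (u · s (suc c)) →
  SameW u (s a · u)
    ⇔ (2 ≤ suc c × suc c ≤ (c + suc (suc r)) ∸ 2 × SameSide a (app u c) (app u (suc c + 2)))
adjacentTransposition⇔ c r u {a} 1≤a a<n H =
  ⇔.trans (SameW⇔SameRunShape {σ = u} {s a · u} first-direction)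
  (⇔.trans words⇔
  (⇔.trans (SameRunShape-swap-normalise P Q adjacent)
           (adjacentSwap⇔ (app u) c r f-outside)))
  where
  -- The paper's b is suc c; f and g read u and s a · u at 0-based positions, so f c = u(b).
  f g : ℕ → ℕ
  f = app u ∘ suc
  g = app (s a · u) ∘ suc

  g-c : g c ≡ f (suc c)
  g-c = trans (app-cong H (<-trans (n<1+n c) (1+m<m+2+n c r))) (app-·s u (1+m<m+2+n c r))

  open AdjacentTransposition {r = r} {f = f} {g} (app-injective u) (app-s· u 1≤a a<n) g-c

  P Q : List ℕ
  P = applyUpTo f c
  Q = after f c r

  word-u : word u ≡ P ++ f c ∷ f (suc c) ∷ Q
  word-u = trans (word≡applyUpTo u) (applyUpTo-split f c r)

  word-u′ : word (s a · u) ≡ P ++ f (suc c) ∷ f c ∷ Q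
  word-u′ = trans (word≡applyUpTo (s a · u)) applyUpTo-g

  first-direction : ∃[ d ] head (dirs (word u)) ≡ just d
  first-direction =
    subst (λ w → ∃[ d ] head (dirs w) ≡ just d) (sym word-u) (head-dirs-++-∷-∷ P _ _ Q)

  words⇔ : SameRunShape (dirs (word u)) (dirs (word (s a · u)))
         ⇔ SameRunShape (dirs (P ++ f c ∷ f (suc c) ∷ Q)) (dirs (P ++ f (suc c) ∷ f c ∷ Q))
  words⇔ rewrite word-u | word-u′ = ⇔.refl

≤∸1⇒< : ∀ {a n} → 1 ≤ n → a ≤ n ∸ 1 → a < n
≤∸1⇒< {n = suc n} _ a≤n = s≤s a≤n

length-split : ∀ {c n} → suc c ≤ n ∸ 1 → ∃[ r ] c + suc (suc r) ≡ n
length-split {c} {suc n} 1+c≤n with r , c+r≡n ← m≤n⇒∃[o]m+o≡n 1+c≤n =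
  r , trans (+-suc c (suc r)) (cong suc (trans (+-suc c r) c+r≡n))

lemma3p5 : (n : ℕ) → 2 ≤ n → (u : Permutation′ n) → (a b : ℕ)
    → 1 ≤ a → a ≤ n ∸ 1 → 1 ≤ b → b ≤ n ∸ 1
    → (s a · u) ≈ (u · s b)
    → (∃[ m ] ((W⁺ m u × W⁺ m (s a · u)) ⊎ (W⁻ m u × W⁻ m (s a · u))))
      ⇔ (2 ≤ b × b ≤ n ∸ 2
         × ((app u (b ∸ 1) < a × app u (b + 2) < a)
            ⊎ (app u (b ∸ 1) > a + 1 × app u (b + 2) > a + 1)))
lemma3p5 n _   u a zero    _   _     ()  _       _
lemma3p5 n 2≤n u a (suc c) 1≤a a≤n∸1 _ 1+c≤n∸1 H
  with a<n ← ≤∸1⇒< (<⇒≤ 2≤n) a≤n∸1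
  with r , refl ← length-split {n = n} 1+c≤n∸1
  = adjacentTransposition⇔ c r u 1≤a a<n H
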